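{- Let $G=(V,E)$ be a finite undirected graph, let $T$ be a rooted spanning tree of $G$ with root $r_T$, and let $A\subset V$. Suppose $E(T)\cap\delta(A)=\{e_T(v_1),\dots,e_T(v_k)\}$ for some distinct vertices $S=\{v_1,\dots,v_k\}\subseteq V\setminus\{r_T\}$. Then $|\delta(A)|$ is determined by (can be computed from) the following data: the values $|\delta(x^{\downarrow T})|$ for all $x\in S$; the values $|\delta(x^{\downarrow T})\cap\delta(y^{\downarrow T})|$ for all $x,y\in S$; and the path in $T$ from $r_T$ to $x$ for every $x\in S$.
   Context: $E(T)$ is the set of edges of $T$. For a vertex $v\neq r_T$, $e_T(v)$ denotes the tree edge joining $v$ to its parent in $T$. For $v\in V$, $v^{\downarrow T}$ is the set of descendants of $v$ in $T$, including $v$ itself. For $B\subseteq V$, $\delta(B)$ is the set of edges of $G$ with exactly one endpoint in $B$. -}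

module Defs where

open import Data.Nat using (ℕ; zero; suc; _<ᵇ_)
open import Data.Bool using (Bool; true; false; if_then_else_; _xor_; _∧_; not)
open import Data.Fin using (Fin; toℕ)
open import Data.Fin.Properties using (_≟_)
open import Data.List using (List; []; _∷_; length; filterᵇ; concatMap; map; allFin; reverse)
open import Data.Product using (_×_; _,_; ∃)
open import Relation.Nullary.Decidable using (⌊_⌋)
open import Relation.Binary.PropositionalEquality using (_≡_; _≢_)

record Graph (n : ℕ) : Set where
  field
    adj       : Fin n → Fin n → Bool
    adj-sym   : ∀ u v → adj u v ≡ adj v u
    adj-irrefl : ∀ v → adj v v ≡ false
open Graph public

iter : {A : Set} → (A → A) → ℕ → A → A
iter f zero    x = x
iter f (suc k) x = f (iter f k x)

-- Tree edges are exactly { v , parent v } for v ≢ root; every such pair is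
-- an edge of G; every vertex reaches the root by following parents
-- (so T is acyclic and spanning).
record RootedSpanningTree {n : ℕ} (G : Graph n) : Set where
  field
    root        : Fin n
    parent      : Fin n → Fin n
    parent-root : parent root ≡ root
    tree-edge   : ∀ v → v ≢ root → adj G v (parent v) ≡ true
    reaches     : ∀ v → ∃ λ k → iter parent k v ≡ root
open RootedSpanningTree public

Subset : ℕ → Set
Subset n = Fin n → Bool

_==_ : {n : ℕ} → Fin n → Fin n → Bool
u == v = ⌊ u ≟ v ⌋

anyᵇ : {A : Set} → (A → Bool) → List A → Bool
anyᵇ p []       = false
anyᵇ p (x ∷ xs) = if p x then true else anyᵇ p xs

-- x^{↓T}: the descendants of x in T (including x): w is a descendant of x iff
-- x = parent^k(w) for some k.  Every vertex has depth < n, so k < n suffices.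
desc : {n : ℕ} {G : Graph n} → RootedSpanningTree G → Fin n → Subset n
desc {n} T x w = anyᵇ (λ k → iter (parent T) k w == x) (Data.List.upTo n)
  where import Data.List

pairs : (n : ℕ) → List (Fin n × Fin n)
pairs n = concatMap (λ u → map (u ,_) (filterᵇ (λ v → toℕ u <ᵇ toℕ v) (allFin n))) (allFin n)

edges : {n : ℕ} → Graph n → List (Fin n × Fin n)
edges {n} G = filterᵇ (λ { (u , v) → adj G u v }) (pairs n)

crosses : {n : ℕ} → Subset n → Fin n × Fin n → Bool
crosses B (u , v) = B u xor B v

δ-size : {n : ℕ} → Graph n → Subset n → ℕ
δ-size G B = length (filterᵇ (crosses B) (edges G))

δ∩δ-size : {n : ℕ} → Graph n → Subset n → Subset n → ℕ
δ∩δ-size G B C = length (filterᵇ (λ e → crosses B e ∧ crosses C e) (edges G))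

-- the vertex sequence x , parent x , … , root (fuel-bounded; depth < n)
pathUp : {n : ℕ} {G : Graph n} → RootedSpanningTree G → ℕ → Fin n → List (Fin n)
pathUp T zero    x = x ∷ []
pathUp T (suc k) x = if x == root T then x ∷ [] else x ∷ pathUp T k (parent T x)

rootPath : {n : ℕ} {G : Graph n} → RootedSpanningTree G → Fin n → List (Fin n)
rootPath {n} T x = reverse (pathUp T n x)

-- The hypothesis E(T) ∩ δ(A) = { e_T(v) : v ∈ S } with S ⊆ V ∖ {r_T}:
-- the tree edge e_T(v) = {v , parent v} (v ≢ root) lies in δ(A) iff v ∈ S.
CutTreeEdges : {n : ℕ} {G : Graph n} → RootedSpanningTree G → Subset n → Subset n → Set
CutTreeEdges T A S =
  (S (root T) ≡ false) ×
  (∀ v → v ≢ root T → (A v xor A (parent T v)) ≡ S v)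

-- Let σ w = [A w ≠ A r_T]. Walking up the tree from w, σ changes exactly across the edges
-- e_T(v), v ∈ S, so σ = Σ_{x ∈ S} ε_x 1_{x↓}, where ε_x = ±1 records σ x, i.e. the parity of S
-- along the root path of x. An edge uv crosses A iff (σ u − σ v)² = 1, and expanding
-- the square gives
--   |δ(A)| = Σ_{x,y ∈ S} ε_x ε_y ν_{xy} |δ(x↓) ∩ δ(y↓)|,
-- where ν_{xy} = 1 if x↓ and y↓ are nested (one of x, y lies on the root path of the other) and
-- ν_{xy} = −1 if they are disjoint. Every quantity on the right is part of the data.
module Submission where

open import Defs
open import Data.Nat as ℕ using (ℕ; zero; suc; _<_; _≤_; z≤n; s≤s)
import Data.Nat.Properties as ℕP
open import Data.Nat.Induction using (<-wellFounded)
open import Induction.WellFounded using (Acc; acc)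
open import Data.Bool as Bool using (Bool; true; false; _xor_; _∧_; _∨_; b≤b; f≤t)
open import Data.Bool.Properties
  using (xor-same; xor-inverseˡ; xor-inverseʳ; ∧-comm; ≤-minimum; T-≡)
open import Data.Fin using (Fin; toℕ; punchIn)
import Data.Fin.Properties as FinP
open import Data.Integer using (ℤ; +_; _+_; _*_; _-_; -_; 0ℤ; 1ℤ; -1ℤ)
import Data.Integer.Properties as ℤP
open import Data.Integer.Tactic.RingSolver using (solve-∀)
open import Data.List using (List; []; _∷_; filterᵇ; length; foldl; foldr; upTo)
open import Data.List.Properties using (reverse-foldl)
open import Data.List.Relation.Unary.Any using (here; there)
open import Data.List.Relation.Unary.Any.Properties using (reverse⁺; reverse⁻)
open import Data.List.Membership.Propositional using (_∈_)
open import Data.List.Membership.Propositional.Properties using (∈-upTo⁺)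
import Data.List.Membership.DecPropositional as DecMembership
open import Data.Product using (_×_; _,_; ∃; proj₁; proj₂)
open import Data.Sum using (_⊎_; inj₁; inj₂) renaming ([_,_] to either)
open import Data.Empty using (⊥-elim)
open import Function using (_∘_; Equivalence)
open import Relation.Nullary using (¬_; yes; no; does; contradiction)
open import Relation.Nullary.Decidable using (toWitness; isYes≗does; dec-true; dec-false)
open import Relation.Binary.PropositionalEquality
open import Algebra.Properties.Semiring.Sum ℤP.+-*-semiring
  using (sum; sum-syntax; sum-cong-≗; sum-replicate-zero; sum-remove; ∑-distrib-+;
         *-distribˡ-sum; *-distribʳ-sum)

iter-sucʳ : ∀ {A : Set} (f : A → A) k x → iter f (suc k) x ≡ iter f k (f x)
iter-sucʳ f zero    x = refl
iter-sucʳ f (suc k) x = cong f (iter-sucʳ f k x)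

iter-+ : ∀ {A : Set} (f : A → A) j k x → iter f (j ℕ.+ k) x ≡ iter f j (iter f k x)
iter-+ f zero    k x = refl
iter-+ f (suc j) k x = cong f (iter-+ f j k x)

iter-fixed : ∀ {A : Set} (f : A → A) {x} → f x ≡ x → ∀ k → iter f k x ≡ x
iter-fixed f fx≡x zero    = refl
iter-fixed f fx≡x (suc k) = trans (cong f (iter-fixed f fx≡x k)) fx≡x

module _ {n : ℕ} (f : Fin n → Fin n) where

  iter-shortcut : ∀ {a b x} → iter f a x ≡ iter f b x →
                  ∀ m → iter f (m ℕ.+ a) x ≡ iter f (m ℕ.+ b) x
  iter-shortcut {a} {b} {x} eq m =
    trans (iter-+ f m a x) (trans (cong (iter f m) eq) (sym (iter-+ f m b x)))

  -- Among x, f x, …, fⁿ x two points coincide, so a longer walk can be shortened.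
  iter-within : ∀ k {x y} → iter f k x ≡ y → ∃ λ j → j < n × iter f j x ≡ y
  iter-within k = go k (<-wellFounded k)
    where
    go : ∀ k {x y} → Acc _<_ k → iter f k x ≡ y → ∃ λ j → j < n × iter f j x ≡ y
    go k {x} (acc shorter) fᵏx≡y with k ℕ.<? n
    ... | yes k<n = k , k<n , fᵏx≡y
    ... | no k≮n with FinP.pigeonhole (ℕP.n<1+n n) (λ i → iter f (toℕ i) x)
    ... | i , j , i<j , fⁱx≡fʲx =
      go m′ (shorter m′<k)
         (trans (iter-shortcut fⁱx≡fʲx m) (trans (cong (λ t → iter f t x) m+j≡k) fᵏx≡y))
      where
      m m′ : ℕ
      m = k ℕ.∸ toℕ j
      m′ = m ℕ.+ toℕ i
      m+j≡k : m ℕ.+ toℕ j ≡ k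
      m+j≡k = ℕP.m∸n+n≡m (ℕP.≤-trans (ℕP.≤-pred (FinP.toℕ<n j)) (ℕP.≮⇒≥ k≮n))
      m′<k : m′ < k
      m′<k = ℕP.<-≤-trans (ℕP.+-monoʳ-< m i<j) (ℕP.≤-reflexive m+j≡k)

==⇒≡ : ∀ {n} {u v : Fin n} → (u == v) ≡ true → u ≡ v
==⇒≡ eq = toWitness (Equivalence.from T-≡ eq)

≡⇒== : ∀ {n} {u v : Fin n} → u ≡ v → (u == v) ≡ true
≡⇒== {u = u} {v} u≡v = trans (isYes≗does (u FinP.≟ v)) (dec-true (u FinP.≟ v) u≡v)

≢⇒==false : ∀ {n} {u v : Fin n} → u ≢ v → (u == v) ≡ false
≢⇒==false {u = u} {v} u≢v = trans (isYes≗does (u FinP.≟ v)) (dec-false (u FinP.≟ v) u≢v)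

==false⇒≢ : ∀ {n} {u v : Fin n} → (u == v) ≡ false → u ≢ v
==false⇒≢ eq u≡v with () ← trans (sym eq) (≡⇒== u≡v)

anyᵇ-sound : ∀ {A : Set} (q : A → Bool) xs → anyᵇ q xs ≡ true →
             ∃ λ x → x ∈ xs × q x ≡ true
anyᵇ-sound q (x ∷ xs) eq with q x in qx
... | true  = x , here refl , qx
... | false with y , y∈xs , qy ← anyᵇ-sound q xs eq = y , there y∈xs , qy

anyᵇ-complete : ∀ {A : Set} (q : A → Bool) {xs x} → x ∈ xs → q x ≡ true → anyᵇ q xs ≡ true
anyᵇ-complete q (here refl) qx rewrite qx = refl
anyᵇ-complete q {y ∷ _} (there x∈xs) qx with q y
... | true  = refl
... | false = anyᵇ-complete q x∈xs qx

xor-cancel-common : ∀ a b c → (a xor c) xor (b xor c) ≡ a xor b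
xor-cancel-common false false c = xor-same c
xor-cancel-common false true  c = xor-inverseʳ c
xor-cancel-common true  false c = xor-inverseˡ c
xor-cancel-common true  true  c = xor-same (Bool.not c)

xor-cancel-outer : ∀ a b → b xor (a xor b) ≡ a
xor-cancel-outer false b = xor-same b
xor-cancel-outer true  b = xor-inverseʳ b

β : Bool → ℤ
β true  = 1ℤ
β false = 0ℤ

sgn : Bool → ℤ
sgn true  = 1ℤ
sgn false = -1ℤ

β-∧ : ∀ a b → β (a ∧ b) ≡ β a * β b
β-∧ false b = refl
β-∧ true  b = sym (ℤP.*-identityˡ (β b))

β-xor-step : ∀ s t → β (s xor t) * sgn s + β t ≡ β s
β-xor-step false false = refl
β-xor-step false true  = refl
β-xor-step true  false = refl
β-xor-step true  true  = refl

β-xor-square : ∀ s t → β (s xor t) ≡ (β s - β t) * (β s - β t)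
β-xor-square false false = refl
β-xor-square false true  = refl
β-xor-square true  false = refl
β-xor-square true  true  = refl

diff-product-≤ : ∀ {a b c d} → a Bool.≤ c → b Bool.≤ d →
                 (β a - β b) * (β c - β d) ≡ β ((a xor b) ∧ (c xor d))
diff-product-≤ {false} {false} b≤b b≤b = refl
diff-product-≤ {false} {true}  b≤b b≤b = refl
diff-product-≤ {true}  {false} b≤b b≤b = refl
diff-product-≤ {true}  {true}  b≤b b≤b = refl
diff-product-≤ {false} b≤b f≤t = refl
diff-product-≤ {true}  b≤b f≤t = refl
diff-product-≤ {b = false} f≤t b≤b = refl
diff-product-≤ {b = true}  f≤t b≤b = refl
diff-product-≤ f≤t f≤t = refl

diff-product-disjoint : ∀ a b c d → a ∧ c ≡ false → b ∧ d ≡ false →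
                        (β a - β b) * (β c - β d) ≡ - β ((a xor b) ∧ (c xor d))
diff-product-disjoint true  _     true  _     () _
diff-product-disjoint _     true  _     true  _  ()
diff-product-disjoint false false false false _ _ = refl
diff-product-disjoint false false true  false _ _ = refl
diff-product-disjoint false false false true  _ _ = refl
diff-product-disjoint false false true  true  _ _ = refl
diff-product-disjoint true  false false false _ _ = refl
diff-product-disjoint true  false false true  _ _ = refl
diff-product-disjoint false true  false false _ _ = refl
diff-product-disjoint false true  true  false _ _ = refl
diff-product-disjoint true  true  false false _ _ = refl

∑-distrib-- : ∀ {n} (f g : Fin n → ℤ) → ∑[ i < n ] (f i - g i) ≡ sum f - sum g
∑-distrib-- {n} f g = trans (∑-distrib-+ f (λ i → - g i)) (cong (λ t → sum f + t) sum-neg)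
  where
  sum-neg : ∑[ i < n ] (- g i) ≡ - sum g
  sum-neg = begin
    ∑[ i < n ] (- g i)       ≡⟨ sum-cong-≗ (λ i → sym (ℤP.-1*i≡-i (g i))) ⟩
    ∑[ i < n ] (-1ℤ * g i)   ≡⟨ sym (*-distribˡ-sum -1ℤ g) ⟩
    -1ℤ * sum g              ≡⟨ ℤP.-1*i≡-i (sum g) ⟩
    - sum g                  ∎
    where open ≡-Reasoning

sum-*-sum : ∀ {m n} (f : Fin m → ℤ) (g : Fin n → ℤ) →
            sum f * sum g ≡ ∑[ i < m ] ∑[ j < n ] (f i * g j)
sum-*-sum f g = trans (*-distribʳ-sum (sum g) f) (sum-cong-≗ (λ i → *-distribˡ-sum (f i) g))

∑-pick : ∀ {n} (g : Fin n → ℤ) u → ∑[ x < n ] (g x * β (u == x)) ≡ g u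
∑-pick {suc n} g u = begin
  ∑[ x < suc n ] (g x * β (u == x))
    ≡⟨ sum-remove {i = u} (λ x → g x * β (u == x)) ⟩
  g u * β (u == u) + ∑[ j < n ] off-diagonal j
    ≡⟨ cong₂ _+_ (cong (λ b → g u * β b) (≡⇒== refl)) (sum-cong-≗ off-diagonal≡0) ⟩
  g u * 1ℤ + ∑[ j < n ] 0ℤ
    ≡⟨ cong₂ _+_ (ℤP.*-identityʳ (g u)) (sum-replicate-zero n) ⟩
  g u + 0ℤ
    ≡⟨ ℤP.+-identityʳ (g u) ⟩
  g u
    ∎
  where
  open ≡-Reasoning
  off-diagonal : Fin n → ℤ
  off-diagonal j = g (punchIn u j) * β (u == punchIn u j)
  off-diagonal≡0 : ∀ j → off-diagonal j ≡ 0ℤ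
  off-diagonal≡0 j =
    trans (cong (λ b → g (punchIn u j) * β b) (≢⇒==false (FinP.punchInᵢ≢i u j ∘ sym)))
          (ℤP.*-zeroʳ (g (punchIn u j)))

count : ∀ {E : Set} → (E → Bool) → List E → ℤ
count q es = + length (filterᵇ q es)

count-∷ : ∀ {E : Set} (q : E → Bool) e es → count q (e ∷ es) ≡ β (q e) + count q es
count-∷ q e es with q e
... | true  = refl
... | false = refl

count-linear : ∀ {E : Set} {m} {q : E → Bool} {r : Fin m → Fin m → E → Bool}
               (w : Fin m → Fin m → ℤ) →
               (∀ e → β (q e) ≡ ∑[ i < m ] ∑[ j < m ] (w i j * β (r i j e))) →
               ∀ es → count q es ≡ ∑[ i < m ] ∑[ j < m ] (w i j * count (r i j) es)
count-linear {m = m} w _ [] = sym (begin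
  ∑[ i < m ] ∑[ j < m ] (w i j * 0ℤ)
    ≡⟨ sum-cong-≗ (λ i → sum-cong-≗ (λ j → ℤP.*-zeroʳ (w i j))) ⟩
  ∑[ i < m ] ∑[ j < m ] 0ℤ
    ≡⟨ sum-cong-≗ {m} (λ i → sum-replicate-zero m) ⟩
  ∑[ i < m ] 0ℤ
    ≡⟨ sum-replicate-zero m ⟩
  0ℤ
    ∎)
  where open ≡-Reasoning
count-linear {m = m} {q} {r} w expand (e ∷ es) = begin
  count q (e ∷ es)
    ≡⟨ count-∷ q e es ⟩
  β (q e) + count q es
    ≡⟨ cong₂ _+_ (expand e) (count-linear w expand es) ⟩
  ∑[ i < m ] ∑[ j < m ] a i j + ∑[ i < m ] ∑[ j < m ] b i j
    ≡⟨ sym (∑-distrib-+ (λ i → sum (a i)) (λ i → sum (b i))) ⟩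
  ∑[ i < m ] (∑[ j < m ] a i j + ∑[ j < m ] b i j)
    ≡⟨ sum-cong-≗ (λ i → sym (∑-distrib-+ (a i) (b i))) ⟩
  ∑[ i < m ] ∑[ j < m ] (a i j + b i j)
    ≡⟨ sum-cong-≗ (λ i → sum-cong-≗ (λ j → merge i j)) ⟩
  ∑[ i < m ] ∑[ j < m ] (w i j * count (r i j) (e ∷ es))
    ∎
  where
  open ≡-Reasoning
  a b : Fin m → Fin m → ℤ
  a i j = w i j * β (r i j e)
  b i j = w i j * count (r i j) es
  merge : ∀ i j → a i j + b i j ≡ w i j * count (r i j) (e ∷ es)
  merge i j = trans (sym (ℤP.*-distribˡ-+ (w i j) _ _)) (cong (w i j *_) (sym (count-∷ (r i j) e es)))

parity : ∀ {n} → Subset n → List (Fin n) → Bool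
parity S = foldl (λ b z → b xor S z) false

comparable : ∀ {n} → (Fin n → List (Fin n)) → Fin n → Fin n → Bool
comparable path x y = does (x ∈? path y) ∨ does (y ∈? path x)
  where open DecMembership FinP._≟_

cutTerm : ∀ {n} → Subset n → (Fin n → List (Fin n)) → (Fin n → Fin n → ℕ) →
          Fin n → Fin n → ℤ
cutTerm S path κ x y =
  β (S x ∧ S y) *
    (sgn (parity S (path x)) * sgn (parity S (path y)) * sgn (comparable path x y) * + κ x y)

cutFormula : ∀ {n} → Subset n → (Fin n → List (Fin n)) → (Fin n → Fin n → ℕ) → ℤ
cutFormula {n} S path κ = ∑[ x < n ] ∑[ y < n ] cutTerm S path κ x y

cutFormula-cong : ∀ {n} (S : Subset n) {path path′ : Fin n → List (Fin n)}
                  {κ κ′ : Fin n → Fin n → ℕ} →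
                  (∀ x → S x ≡ true → path x ≡ path′ x) →
                  (∀ x y → S x ≡ true → S y ≡ true → κ x y ≡ κ′ x y) →
                  cutFormula S path κ ≡ cutFormula S path′ κ′
cutFormula-cong S {path} {path′} {κ} {κ′} path≡ κ≡ =
  sum-cong-≗ λ x → sum-cong-≗ λ y → term≡ x y
  where
  term≡ : ∀ x y → cutTerm S path κ x y ≡ cutTerm S path′ κ′ x y
  term≡ x y with S x in x∈S | S y in y∈S
  ... | true  | true  rewrite path≡ x x∈S | path≡ y y∈S | κ≡ x y x∈S y∈S = refl
  ... | true  | false = refl
  ... | false | _     = refl

module RootedTree {n : ℕ} {G : Graph n} (T : RootedSpanningTree G) where

  r : Fin n
  r = root T

  p : Fin n → Fin n
  p = parent T

  infix 4 _≼_
  _≼_ : Fin n → Fin n → Set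
  x ≼ w = ∃ λ j → iter p j w ≡ x

  ≼-refl : ∀ {x} → x ≼ x
  ≼-refl = 0 , refl

  ≼-trans : ∀ {x y w} → x ≼ y → y ≼ w → x ≼ w
  ≼-trans {w = w} (i , pⁱy≡x) (j , pʲw≡y) =
    i ℕ.+ j , trans (iter-+ p i j w) (trans (cong (iter p i) pʲw≡y) pⁱy≡x)

  parent-≼ : ∀ w → p w ≼ w
  parent-≼ w = 1 , refl

  ≼-root⇒≡ : ∀ {x} → x ≼ r → x ≡ r
  ≼-root⇒≡ (j , pʲr≡x) = trans (sym pʲr≡x) (iter-fixed p (parent-root T) j)

  ≼-ordered : ∀ {i j x y w} → i ≤ j → iter p i w ≡ x → iter p j w ≡ y → y ≼ x
  ≼-ordered {i} {j} {w = w} i≤j pⁱw≡x pʲw≡y = j ℕ.∸ i , (begin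
    iter p (j ℕ.∸ i) _                ≡⟨ cong (iter p (j ℕ.∸ i)) (sym pⁱw≡x) ⟩
    iter p (j ℕ.∸ i) (iter p i w)     ≡⟨ sym (iter-+ p (j ℕ.∸ i) i w) ⟩
    iter p (j ℕ.∸ i ℕ.+ i) w          ≡⟨ cong (λ t → iter p t w) (ℕP.m∸n+n≡m i≤j) ⟩
    iter p j w                        ≡⟨ pʲw≡y ⟩
    _                                 ∎)
    where open ≡-Reasoning

  ≼-connex : ∀ {x y w} → x ≼ w → y ≼ w → x ≼ y ⊎ y ≼ x
  ≼-connex (i , pⁱw≡x) (j , pʲw≡y) with ℕP.≤-total i j
  ... | inj₁ i≤j = inj₂ (≼-ordered i≤j pⁱw≡x pʲw≡y)
  ... | inj₂ j≤i = inj₁ (≼-ordered j≤i pʲw≡y pⁱw≡x)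

  ≼-iterates : ∀ {u} → u ≼ p u → ∀ k → u ≼ iter p k u
  ≼-iterates u≼pu zero = ≼-refl
  ≼-iterates {u} u≼pu (suc k) with ≼-iterates u≼pu k
  ... | zero  , pᵏu≡u = subst (λ w → u ≼ p w) (sym pᵏu≡u) u≼pu
  ... | suc i , eq    = i , trans (sym (iter-sucʳ p i _)) eq

  -- A vertex lying on a cycle of the parent map is an ancestor of the root, hence the root.
  ⋠-parent : ∀ {u} → u ≢ r → ¬ u ≼ p u
  ⋠-parent {u} u≢r u≼pu with k , pᵏu≡r ← reaches T u =
    u≢r (≼-root⇒≡ (subst (u ≼_) pᵏu≡r (≼-iterates u≼pu k)))

  desc⇒≼ : ∀ {x w} → desc T x w ≡ true → x ≼ w
  desc⇒≼ {x} {w} eq with k , _ , pᵏw==x ← anyᵇ-sound (λ k → iter p k w == x) (upTo n) eq =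
    k , ==⇒≡ pᵏw==x

  ≼⇒desc : ∀ {x w} → x ≼ w → desc T x w ≡ true
  ≼⇒desc {x} {w} (j , pʲw≡x) with k , k<n , pᵏw≡x ← iter-within p j pʲw≡x =
    anyᵇ-complete (λ k → iter p k w == x) (∈-upTo⁺ k<n) (≡⇒== pᵏw≡x)

  ⋠⇒desc : ∀ {x w} → ¬ x ≼ w → desc T x w ≡ false
  ⋠⇒desc {x} {w} x⋠w with desc T x w in eq
  ... | true  = contradiction (desc⇒≼ eq) x⋠w
  ... | false = refl

  desc-parent-≢ : ∀ {x u} → u ≢ x → desc T x u ≡ desc T x (p u)
  desc-parent-≢ {x} {u} u≢x with desc T x (p u) in eq
  ... | true  = ≼⇒desc (≼-trans (desc⇒≼ eq) (parent-≼ u))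
  ... | false = ⋠⇒desc λ where
    (zero  , u≡x)  → u≢x u≡x
    (suc j , pʲ⁺¹u≡x) →
      contradiction (trans (sym (≼⇒desc (j , trans (sym (iter-sucʳ p j u)) pʲ⁺¹u≡x))) eq) λ ()

  desc-parent : ∀ {x u} → u ≢ r → β (desc T x u) ≡ β (u == x) + β (desc T x (p u))
  desc-parent {x} {u} u≢r with u FinP.≟ x
  ... | yes refl rewrite ≼⇒desc (≼-refl {u}) | ⋠⇒desc (⋠-parent u≢r) = refl
  ... | no u≢x = trans (cong β (desc-parent-≢ u≢x)) (sym (ℤP.+-identityˡ _))

  desc-root : ∀ x → desc T x r ≡ (r == x)
  desc-root x with r FinP.≟ x
  ... | yes refl = ≼⇒desc ≼-refl
  ... | no r≢x   = ⋠⇒desc (r≢x ∘ sym ∘ ≼-root⇒≡)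

  ∑-desc-root : ∀ (w : Fin n → ℤ) → ∑[ x < n ] (w x * β (desc T x r)) ≡ w r
  ∑-desc-root w = trans (sum-cong-≗ (λ x → cong (λ b → w x * β b) (desc-root x))) (∑-pick w r)

  ∑-desc-parent : ∀ (w : Fin n → ℤ) {u} → u ≢ r →
                  ∑[ x < n ] (w x * β (desc T x u)) ≡ w u + ∑[ x < n ] (w x * β (desc T x (p u)))
  ∑-desc-parent w {u} u≢r = begin
    ∑[ x < n ] (w x * β (desc T x u))
      ≡⟨ sum-cong-≗ (λ x → trans (cong (w x *_) (desc-parent u≢r))
                                  (ℤP.*-distribˡ-+ (w x) (β (u == x)) _)) ⟩
    ∑[ x < n ] (w x * β (u == x) + w x * β (desc T x (p u)))
      ≡⟨ ∑-distrib-+ (λ x → w x * β (u == x)) (λ x → w x * β (desc T x (p u))) ⟩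
    ∑[ x < n ] (w x * β (u == x)) + ∑[ x < n ] (w x * β (desc T x (p u)))
      ≡⟨ cong (λ t → t + ∑[ x < n ] (w x * β (desc T x (p u)))) (∑-pick w u) ⟩
    w u + ∑[ x < n ] (w x * β (desc T x (p u)))
      ∎
    where open ≡-Reasoning

  desc-antitone : ∀ {x y w} → x ≼ y → desc T y w Bool.≤ desc T x w
  desc-antitone {x} {y} {w} x≼y with desc T y w in eq
  ... | false = ≤-minimum _
  ... | true rewrite ≼⇒desc (≼-trans x≼y (desc⇒≼ eq)) = b≤b

  desc-disjoint : ∀ {x y w} → ¬ x ≼ y → ¬ y ≼ x → desc T x w ∧ desc T y w ≡ false
  desc-disjoint {x} {y} {w} x⋠y y⋠x with desc T x w in x≼w | desc T y w in y≼w
  ... | true  | true  = ⊥-elim (either x⋠y y⋠x (≼-connex (desc⇒≼ x≼w) (desc⇒≼ y≼w)))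
  ... | true  | false = refl
  ... | false | _     = refl

  iter-n≡root : ∀ w → iter p n w ≡ r
  iter-n≡root w with k , k<n , pᵏw≡r ← iter-within p (proj₁ (reaches T w)) (proj₂ (reaches T w)) =
    ≼-root⇒≡ (≼-ordered (ℕP.<⇒≤ k<n) pᵏw≡r refl)

  ∈-pathUp⇒≼ : ∀ k {y z} → z ∈ pathUp T k y → z ≼ y
  ∈-pathUp⇒≼ zero (here refl) = ≼-refl
  ∈-pathUp⇒≼ (suc k) {y} z∈ with y == r | z∈
  ... | true  | here refl = ≼-refl
  ... | false | here refl = ≼-refl
  ... | false | there z∈′ = ≼-trans (∈-pathUp⇒≼ k z∈′) (parent-≼ y)

  ≼⇒∈-pathUp : ∀ k j {y z} → j ≤ k → iter p j y ≡ z → z ∈ pathUp T k y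
  ≼⇒∈-pathUp zero    zero    z≤n       refl = here refl
  ≼⇒∈-pathUp (suc k) j       {y} {z} j≤k pʲy≡z with y == r in eq
  ... | true  = here (trans (≼-root⇒≡ (subst (z ≼_) y≡r (j , pʲy≡z))) (sym y≡r))
    where
    y≡r : y ≡ r
    y≡r = ==⇒≡ eq
  ≼⇒∈-pathUp (suc k) zero    _         refl | false = here refl
  ≼⇒∈-pathUp (suc k) (suc j) {y} (s≤s j≤k) pʲ⁺¹y≡z | false =
    there (≼⇒∈-pathUp k j j≤k (trans (sym (iter-sucʳ p j y)) pʲ⁺¹y≡z))

  ∈-rootPath⇒≼ : ∀ {y z} → z ∈ rootPath T y → z ≼ y
  ∈-rootPath⇒≼ z∈ = ∈-pathUp⇒≼ n (reverse⁻ z∈)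

  ≼⇒∈-rootPath : ∀ {y z} → z ≼ y → z ∈ rootPath T y
  ≼⇒∈-rootPath (j , pʲy≡z) with k , k<n , pᵏy≡z ← iter-within p j pʲy≡z =
    reverse⁺ (≼⇒∈-pathUp n k (ℕP.<⇒≤ k<n) pᵏy≡z)

  -- The subtrees x↓ and y↓ are nested when x , y are comparable and disjoint otherwise.
  crossing-product : ∀ x y u v →
    (β (desc T x u) - β (desc T x v)) * (β (desc T y u) - β (desc T y v))
      ≡ sgn (comparable (rootPath T) x y) * β (crosses (desc T x) (u , v) ∧ crosses (desc T y) (u , v))
  crossing-product x y u v with x ∈? rootPath T y | y ∈? rootPath T x
    where open DecMembership FinP._≟_
  ... | yes x∈ | _ =
    trans (ℤP.*-comm (β (desc T x u) - β (desc T x v)) _)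
      (trans (diff-product-≤ (desc-antitone x≼y) (desc-antitone x≼y))
        (trans (cong β (∧-comm (crosses (desc T y) (u , v)) _)) (sym (ℤP.*-identityˡ _))))
    where
    x≼y : x ≼ y
    x≼y = ∈-rootPath⇒≼ x∈
  ... | no _ | yes y∈ =
    trans (diff-product-≤ (desc-antitone y≼x) (desc-antitone y≼x)) (sym (ℤP.*-identityˡ _))
    where
    y≼x : y ≼ x
    y≼x = ∈-rootPath⇒≼ y∈
  ... | no x∉ | no y∉ =
    trans (diff-product-disjoint (desc T x u) (desc T x v) (desc T y u) (desc T y v)
             (desc-disjoint x⋠y y⋠x) (desc-disjoint x⋠y y⋠x))
      (sym (ℤP.-1*i≡-i _))
    where
    x⋠y : ¬ x ≼ y
    x⋠y = x∉ ∘ ≼⇒∈-rootPath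
    y⋠x : ¬ y ≼ x
    y⋠x = y∉ ∘ ≼⇒∈-rootPath

module CutSize {n : ℕ} {G : Graph n} (T : RootedSpanningTree G) (A S : Subset n)
               (cut : CutTreeEdges T A S) where

  open RootedTree T

  side : Subset n
  side w = A w xor A r

  S≡side-xor : ∀ {u} → u ≢ r → S u ≡ side u xor side (p u)
  S≡side-xor {u} u≢r = trans (sym (proj₂ cut u u≢r)) (sym (xor-cancel-common (A u) (A (p u)) (A r)))

  S≡side-root : S r ≡ side r
  S≡side-root = trans (proj₁ cut) (sym (xor-same (A r)))

  xor-along-pathUp : ∀ k x → iter p k x ≡ r →
                     foldr (λ z b → b xor S z) false (pathUp T k x) ≡ side x
  xor-along-pathUp zero    x refl = S≡side-root
  xor-along-pathUp (suc k) x pᵏ⁺¹x≡r with x == r in eq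
  ... | true rewrite ==⇒≡ eq = S≡side-root
  ... | false =
    trans (cong₂ _xor_ (xor-along-pathUp k (p x) (trans (sym (iter-sucʳ p k x)) pᵏ⁺¹x≡r))
                       (S≡side-xor (==false⇒≢ eq)))
          (xor-cancel-outer (side x) (side (p x)))

  parity≡side : ∀ x → parity S (rootPath T x) ≡ side x
  parity≡side x = trans (reverse-foldl (λ b z → b xor S z) false (pathUp T n x))
                        (xor-along-pathUp n x (iter-n≡root x))

  weight : Fin n → ℤ
  weight x = β (S x) * sgn (side x)

  side-parent : ∀ {u} → u ≢ r → β (side u) ≡ weight u + β (side (p u))
  side-parent {u} u≢r =
    trans (sym (β-xor-step (side u) (side (p u))))
          (cong (λ b → β b * sgn (side u) + β (side (p u))) (sym (S≡side-xor u≢r)))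

  side-expansion : ∀ u → β (side u) ≡ ∑[ x < n ] (weight x * β (desc T x u))
  side-expansion u = go (proj₁ (reaches T u)) u (proj₂ (reaches T u))
    where
    open ≡-Reasoning
    go : ∀ k u → iter p k u ≡ r → β (side u) ≡ ∑[ x < n ] (weight x * β (desc T x u))
    go k u pᵏu≡r with u FinP.≟ r
    ... | yes refl = sym (begin
      ∑[ x < n ] (weight x * β (desc T x r)) ≡⟨ ∑-desc-root weight ⟩
      β (S r) * sgn (side r)                 ≡⟨ cong (λ b → β b * sgn (side r)) (proj₁ cut) ⟩
      0ℤ                                     ≡⟨ cong β (sym (xor-same (A r))) ⟩
      β (side r)                             ∎)
    go zero    u u≡r     | no u≢r = contradiction u≡r u≢r
    go (suc k) u pᵏ⁺¹u≡r | no u≢r = begin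
      β (side u)
        ≡⟨ side-parent u≢r ⟩
      weight u + β (side (p u))
        ≡⟨ cong (λ t → weight u + t) (go k (p u) (trans (sym (iter-sucʳ p k u)) pᵏ⁺¹u≡r)) ⟩
      weight u + ∑[ x < n ] (weight x * β (desc T x (p u)))
        ≡⟨ sym (∑-desc-parent weight u≢r) ⟩
      ∑[ x < n ] (weight x * β (desc T x u))
        ∎

  crossWeight : Fin n → Fin n → ℤ
  crossWeight x y = weight x * weight y * sgn (comparable (rootPath T) x y)

  crossesBoth : Fin n → Fin n → Fin n × Fin n → Bool
  crossesBoth x y e = crosses (desc T x) e ∧ crosses (desc T y) e

  edge-expansion : ∀ e →
                   β (crosses A e) ≡ ∑[ x < n ] ∑[ y < n ] (crossWeight x y * β (crossesBoth x y e))
  edge-expansion (u , v) = begin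
    β (A u xor A v)
      ≡⟨ cong β (sym (xor-cancel-common (A u) (A v) (A r))) ⟩
    β (side u xor side v)
      ≡⟨ β-xor-square (side u) (side v) ⟩
    (β (side u) - β (side v)) * (β (side u) - β (side v))
      ≡⟨ cong (λ t → t * t) side-difference ⟩
    sum g * sum g
      ≡⟨ sum-*-sum g g ⟩
    ∑[ x < n ] ∑[ y < n ] (g x * g y)
      ≡⟨ sum-cong-≗ (λ x → sum-cong-≗ (λ y → g-product x y)) ⟩
    ∑[ x < n ] ∑[ y < n ] (crossWeight x y * β (crossesBoth x y (u , v)))
      ∎
    where
    open ≡-Reasoning

    d : Fin n → ℤ
    d x = β (desc T x u) - β (desc T x v)

    g : Fin n → ℤ
    g x = weight x * d x

    factor : ∀ a b c → a * b - a * c ≡ a * (b - c)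
    factor = solve-∀

    side-difference : β (side u) - β (side v) ≡ sum g
    side-difference = begin
      β (side u) - β (side v)
        ≡⟨ cong₂ _-_ (side-expansion u) (side-expansion v) ⟩
      ∑[ x < n ] (weight x * β (desc T x u)) - ∑[ x < n ] (weight x * β (desc T x v))
        ≡⟨ sym (∑-distrib-- (λ x → weight x * β (desc T x u))
                            (λ x → weight x * β (desc T x v))) ⟩
      ∑[ x < n ] (weight x * β (desc T x u) - weight x * β (desc T x v))
        ≡⟨ sum-cong-≗ (λ x → factor (weight x) _ _) ⟩
      sum g
        ∎

    g-product : ∀ x y → g x * g y ≡ crossWeight x y * β (crossesBoth x y (u , v))
    g-product x y = trans (regroup (weight x) (d x) (weight y) (d y))
                      (trans (cong (weight x * weight y *_) (crossing-product x y u v))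
                             (sym (ℤP.*-assoc (weight x * weight y) _ _)))
      where
      regroup : ∀ a b c e → (a * b) * (c * e) ≡ a * c * (b * e)
      regroup = solve-∀

  crossWeight≡cutTerm : ∀ (κ : Fin n → Fin n → ℕ) x y →
                        crossWeight x y * + κ x y ≡ cutTerm S (rootPath T) κ x y
  crossWeight≡cutTerm κ x y = begin
    β (S x) * sgn (side x) * (β (S y) * sgn (side y)) * ν * + κ x y
      ≡⟨ regroup (β (S x)) (sgn (side x)) (β (S y)) (sgn (side y)) ν (+ κ x y) ⟩
    β (S x) * β (S y) * (sgn (side x) * sgn (side y) * ν * + κ x y)
      ≡⟨ cong₂ _*_ (sym (β-∧ (S x) (S y)))
                   (cong₂ (λ s t → sgn s * sgn t * ν * + κ x y)
                          (sym (parity≡side x)) (sym (parity≡side y))) ⟩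
    cutTerm S (rootPath T) κ x y
      ∎
    where
    open ≡-Reasoning
    ν : ℤ
    ν = sgn (comparable (rootPath T) x y)
    regroup : ∀ a s b t c e → a * s * (b * t) * c * e ≡ a * b * (s * t * c * e)
    regroup = solve-∀

  cutSize-formula :
    + δ-size G A ≡ cutFormula S (rootPath T) (λ x y → δ∩δ-size G (desc T x) (desc T y))
  cutSize-formula =
    trans (count-linear crossWeight edge-expansion (edges G))
          (sum-cong-≗ (λ x → sum-cong-≗ (λ y → crossWeight≡cutTerm κ x y)))
    where
    κ : Fin n → Fin n → ℕ
    κ x y = δ∩δ-size G (desc T x) (desc T y)

theorem1p2 : ∀ {n : ℕ} (G G' : Graph n) (T : RootedSpanningTree G) (T' : RootedSpanningTree G')
    (A A' S : Subset n) →
    CutTreeEdges T A S → CutTreeEdges T' A' S →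
    (∀ x → S x ≡ true → δ-size G (desc T x) ≡ δ-size G' (desc T' x)) →
    (∀ x y → S x ≡ true → S y ≡ true →
      δ∩δ-size G (desc T x) (desc T y) ≡ δ∩δ-size G' (desc T' x) (desc T' y)) →
    (∀ x → S x ≡ true → rootPath T x ≡ rootPath T' x) →
    δ-size G A ≡ δ-size G' A'
-- |δ(x↓)| is the diagonal datum |δ(x↓) ∩ δ(x↓)|.
theorem1p2 G G' T T' A A' S cut cut' _ same-δ∩δ same-path = ℤP.+-injective (begin
  + δ-size G A
    ≡⟨ CutSize.cutSize-formula T A S cut ⟩
  cutFormula S (rootPath T) (λ x y → δ∩δ-size G (desc T x) (desc T y))
    ≡⟨ cutFormula-cong S same-path same-δ∩δ ⟩
  cutFormula S (rootPath T') (λ x y → δ∩δ-size G' (desc T' x) (desc T' y))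
    ≡⟨ sym (CutSize.cutSize-formula T' A' S cut') ⟩
  + δ-size G' A'
    ∎)
  where open ≡-Reasoning
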